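{- Let $k\in\mathbb{Z}_{\geq1}$. Then $P_k(z)\in\langle z,z^3,\ldots,z^k\rangle_{\mathbb{Q}}$ if $k$ is odd, and $P_k(z)\in\langle z^2,z^4,\ldots,z^k\rangle_{\mathbb{Q}}$ if $k$ is even.
   Context: Let $\lambda(u)=\frac{1}{e^u-1}-\frac1u+\frac12$ (holomorphic in $|u|<2\pi$), and define $P_k(z)$ for $z\in\mathbb{C}$ by the generating function $e^{ -z\lambda(u)}=\sum_{k=0}^\infty P_k(z)u^k$. For a finite set $S$, $\langle S\rangle_{\mathbb{Q}}$ denotes the $\mathbb{Q}$-linear span of $S$ (here a subspace of $\mathbb{Q}[z]$). -}

module Defs where

open import Data.Nat as ℕ using (ℕ; zero; suc; _∸_; _≤?_; _≟_)
open import Data.Integer using (+_)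
open import Data.Rational as ℚ using (ℚ; 0ℚ; 1ℚ; _+_; _*_; -_)
open import Data.List using (List; upTo; map)
open import Relation.Nullary using (yes; no)
open import Relation.Binary.PropositionalEquality using (_≡_)

sumTo : ℕ → (ℕ → ℚ) → ℚ
sumTo zero    f = f 0
sumTo (suc n) f = sumTo n f + f (suc n)

sumList : List ℕ → (ℕ → ℚ) → ℚ
sumList Data.List.[] f = 0ℚ
sumList (e Data.List.∷ es) f = f e + sumList es f

invFact : ℕ → ℚ
invFact zero    = 1ℚ
invFact (suc n) = invFact n * ((+ 1) ℚ./ suc n)

-- λ(u) = 1/(e^u - 1) - 1/u + 1/2 as a formal power series in u over ℚ.

-- Coefficients of (e^u - 1)/u = Σ_n u^n/(n+1)!
expm1Div : ℕ → ℚ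
expm1Div n = invFact (suc n)

-- Table of the coefficients β_0..β_n of u/(e^u - 1), the multiplicative
-- inverse of (e^u - 1)/u (whose constant term is 1):
--   β_0 = 1,   β_m = - Σ_{i=1}^{m} expm1Div i * β_{m-i}   (m ≥ 1).
-- (βTable n i is β_i for i ≤ n, and 0 for i > n.)
βTable : ℕ → ℕ → ℚ
βTable zero i with i ≟ 0
... | yes _ = 1ℚ
... | no  _ = 0ℚ
βTable (suc n) i with i ℕ.≤? n
... | yes _ = βTable n i
... | no  _ with i ≟ suc n
...   | yes _ = - sumTo n (λ j → expm1Div (suc j) * βTable n (n ∸ j))
...   | no  _ = 0ℚ

β : ℕ → ℚ
β n = βTable n n

-- 1/(e^u-1) = Σ_n β_n u^(n-1); subtracting 1/u (= β_0 u^(-1)) and adding 1/2: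
-- λ(u) = Σ_m λc m u^m  with  λc m = β_(m+1) + [m = 0]·1/2.
λc : ℕ → ℚ
λc zero    = β 1 + ℚ.½
λc (suc m) = β (suc (suc m))

-- Formal power series in u with coefficients in ℚ[z]:
-- F k j = coefficient of u^k z^j.
BiSeries : Set
BiSeries = ℕ → ℕ → ℚ

_⊛_ : BiSeries → BiSeries → BiSeries
(f ⊛ g) k j = sumTo k (λ a → sumTo j (λ b → f a b * g (k ∸ a) (j ∸ b)))

oneS : BiSeries
oneS zero zero = 1ℚ
oneS _    _    = 0ℚ

powS : BiSeries → ℕ → BiSeries
powS f zero    = oneS
powS f (suc n) = powS f n ⊛ f

minusZλ : BiSeries
minusZλ k 1 = - λc k
minusZλ k _ = 0ℚ

-- exp(F) = Σ_n F^n/n!  for F with zero u-constant term; the coefficient of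
-- u^k only receives contributions from n ≤ k (F^n has u-order ≥ n).
expS : BiSeries → BiSeries
expS f k j = sumTo k (λ n → invFact n * powS f n k j)

-- e^{-zλ(u)} = Σ_k P_k(z) u^k ; P k j = coefficient of z^j in P_k(z).
P : ℕ → ℕ → ℚ
P k j = expS minusZλ k j

monomial : ℕ → ℕ → ℚ
monomial e j with e ≟ j
... | yes _ = 1ℚ
... | no  _ = 0ℚ

InMonomialSpan : (ℕ → ℚ) → List ℕ → Set
InMonomialSpan p es =
  Σ (ℕ → ℚ) λ c → ∀ j → p j ≡ sumList es (λ e → c e * monomial e j)
  where open import Data.Product using (Σ)

oddsUpTo : ℕ → List ℕ
oddsUpTo m = map (λ i → suc (2 ℕ.* i)) (upTo m)

evensUpTo : ℕ → List ℕ
evensUpTo m = map (λ i → suc (suc (2 ℕ.* i))) (upTo m)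

-- λ(u) is odd, so every term of -zλ(u) has the shape c u^k z with k odd.  The exponents (k, j) of
-- such terms generate the additive monoid of pairs with j ≤ k, j ≡ k (mod 2) and j = 0 only if
-- k = 0, and a product of power series supported in an additive monoid is again supported there;
-- hence so is e^(-zλ(u)) = Σ (-zλ(u))^n / n!, which is the claim.
-- Oddness of λ is the vanishing of the odd Bernoulli numbers beyond B₁: with β(u) = u/(e^u - 1),
-- β(-u) = u + β(u), because both sides multiplied by (e^u - 1)/u give e^u.  This uses e^u e^(-u) = 1,
-- which holds because its derivative vanishes.
module Submission where

open import Defs
open import Data.Nat as ℕ using (ℕ)
open import Relation.Nullary using (Dec)

module Sums where

  open import Data.Nat using (zero; suc; _∸_; _≤_; z≤n)
  import Data.Nat.Properties as ℕ
  open import Data.Rational using (ℚ; 0ℚ; _+_; _*_; -_)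
  open import Data.Rational.Properties
  open import Algebra.Bundles using (CommutativeMonoid)
  open import Algebra.Properties.CommutativeSemigroup (CommutativeMonoid.commutativeSemigroup +-0-commutativeMonoid)
    using (interchange)
  open import Function using (_∘_)
  open import Relation.Binary.PropositionalEquality
  open ≡-Reasoning

  sumTo-cong : ∀ n {f g : ℕ → ℚ} → (∀ {i} → i ≤ n → f i ≡ g i) → sumTo n f ≡ sumTo n g
  sumTo-cong zero    f≡g = f≡g z≤n
  sumTo-cong (suc n) f≡g = cong₂ _+_ (sumTo-cong n (f≡g ∘ ℕ.m≤n⇒m≤1+n)) (f≡g ℕ.≤-refl)

  sumTo-zero : ∀ n {f : ℕ → ℚ} → (∀ {i} → i ≤ n → f i ≡ 0ℚ) → sumTo n f ≡ 0ℚ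
  sumTo-zero zero    f≡0 = f≡0 z≤n
  sumTo-zero (suc n) f≡0 = cong₂ _+_ (sumTo-zero n (f≡0 ∘ ℕ.m≤n⇒m≤1+n)) (f≡0 ℕ.≤-refl)

  sumTo-+ : ∀ n (f g : ℕ → ℚ) → sumTo n (λ i → f i + g i) ≡ sumTo n f + sumTo n g
  sumTo-+ zero    f g = refl
  sumTo-+ (suc n) f g = begin
    sumTo n (λ i → f i + g i) + (f (suc n) + g (suc n))
      ≡⟨ cong (_+ (f (suc n) + g (suc n))) (sumTo-+ n f g) ⟩
    (sumTo n f + sumTo n g) + (f (suc n) + g (suc n))
      ≡⟨ interchange (sumTo n f) (sumTo n g) (f (suc n)) (g (suc n)) ⟩
    sumTo (suc n) f + sumTo (suc n) g ∎

  sumTo-*ˡ : ∀ n c (f : ℕ → ℚ) → sumTo n (λ i → c * f i) ≡ c * sumTo n f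
  sumTo-*ˡ zero    c f = refl
  sumTo-*ˡ (suc n) c f =
    trans (cong (_+ c * f (suc n)) (sumTo-*ˡ n c f)) (sym (*-distribˡ-+ c (sumTo n f) (f (suc n))))

  sumTo-*ʳ : ∀ n c (f : ℕ → ℚ) → sumTo n (λ i → f i * c) ≡ sumTo n f * c
  sumTo-*ʳ n c f = trans (sumTo-cong n (λ {i} _ → *-comm (f i) c)) (trans (sumTo-*ˡ n c f) (*-comm c (sumTo n f)))

  sumTo-neg : ∀ n (f : ℕ → ℚ) → sumTo n (λ i → - f i) ≡ - sumTo n f
  sumTo-neg zero    f = refl
  sumTo-neg (suc n) f = trans (cong (_+ - f (suc n)) (sumTo-neg n f)) (sym (neg-distrib-+ (sumTo n f) (f (suc n))))

  sumTo-sucˡ : ∀ n (f : ℕ → ℚ) → sumTo (suc n) f ≡ f 0 + sumTo n (f ∘ suc)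
  sumTo-sucˡ zero    f = refl
  sumTo-sucˡ (suc n) f =
    trans (cong (_+ f (suc (suc n))) (sumTo-sucˡ n f)) (+-assoc (f 0) (sumTo n (f ∘ suc)) (f (suc (suc n))))

  sumTo-reverse : ∀ n (f : ℕ → ℚ) → sumTo n f ≡ sumTo n (λ i → f (n ∸ i))
  sumTo-reverse zero    f = refl
  sumTo-reverse (suc n) f = begin
    sumTo n f + f (suc n)                      ≡⟨ +-comm (sumTo n f) (f (suc n)) ⟩
    f (suc n) + sumTo n f                      ≡⟨ cong (f (suc n) +_) (sumTo-reverse n f) ⟩
    f (suc n) + sumTo n (λ i → f (n ∸ i))      ≡⟨ sumTo-sucˡ n (λ i → f (suc n ∸ i)) ⟨
    sumTo (suc n) (λ i → f (suc n ∸ i))        ∎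

  sumTo-triangle : ∀ n (F : ℕ → ℕ → ℚ) →
    sumTo n (λ i → sumTo i (F i)) ≡ sumTo n (λ j → sumTo (n ∸ j) (λ k → F (j ℕ.+ k) j))
  sumTo-triangle zero    F = refl
  sumTo-triangle (suc n) F = begin
    sumTo n (λ i → sumTo i (F i)) + sumTo (suc n) (F (suc n))
      ≡⟨ cong (_+ sumTo (suc n) (F (suc n))) (sumTo-triangle n F) ⟩
    sumTo n column + (sumTo n (F (suc n)) + F (suc n) (suc n))
      ≡⟨ +-assoc (sumTo n column) (sumTo n (F (suc n))) (F (suc n) (suc n)) ⟨
    (sumTo n column + sumTo n (F (suc n))) + F (suc n) (suc n)
      ≡⟨ cong₂ _+_ (sumTo-+ n column (F (suc n))) (cong (λ m → F m (suc n)) (ℕ.+-identityʳ (suc n))) ⟨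
    sumTo n (λ j → column j + F (suc n) j) + F (suc n ℕ.+ 0) (suc n)
      ≡⟨ cong₂ _+_ (sumTo-cong n extend)
                   (cong (λ m → sumTo m (λ k → F (suc n ℕ.+ k) (suc n))) (ℕ.n∸n≡0 n)) ⟨
    sumTo (suc n) (λ j → sumTo (suc n ∸ j) (λ k → F (j ℕ.+ k) j)) ∎
    where
    column : ℕ → ℚ
    column j = sumTo (n ∸ j) (λ k → F (j ℕ.+ k) j)
    extend : ∀ {j} → j ≤ n → sumTo (suc n ∸ j) (λ k → F (j ℕ.+ k) j) ≡ column j + F (suc n) j
    extend {j} j≤n rewrite ℕ.+-∸-assoc 1 j≤n =
      cong (λ m → column j + F m j) (trans (ℕ.+-suc j (n ∸ j)) (cong suc (ℕ.m+[n∸m]≡n j≤n)))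

module PowerSeries where

  open Sums
  open import Data.Nat using (zero; suc; _∸_; _≤_)
  import Data.Nat.Properties as ℕ
  open import Data.Integer as ℤ using (+_)
  import Data.Integer.Properties as ℤ
  open import Data.Rational using (ℚ; 0ℚ; 1ℚ; _+_; _*_; -_; _/_; toℚᵘ)
  open import Data.Rational.Literals using (fromℤ)
  open import Data.Rational.Properties
  import Data.Rational.Unnormalised as ℚᵘ
  import Data.Rational.Unnormalised.Properties as ℚᵘ
  open import Data.Rational.Solver using (module +-*-Solver)
  open +-*-Solver using (solve; _:+_; _:*_; :-_; _:=_)
  open import Algebra.Properties.Group +-0-group using (inverseʳ-unique) renaming (⁻¹-involutive to neg-involutive)
  open import Function using (_∘_)
  open import Relation.Binary.PropositionalEquality
  open ≡-Reasoning

  Series : Set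
  Series = ℕ → ℚ

  infixl 7 _∗_

  _∗_ : Series → Series → Series
  (f ∗ g) n = sumTo n (λ i → f i * g (n ∸ i))

  δ : Series
  δ zero    = 1ℚ
  δ (suc _) = 0ℚ

  X : Series
  X 1 = 1ℚ
  X _ = 0ℚ

  ∗-comm : ∀ f g → f ∗ g ≗ g ∗ f
  ∗-comm f g n = trans (sumTo-reverse n _) (sumTo-cong n swap)
    where
    swap : ∀ {i} → i ≤ n → f (n ∸ i) * g (n ∸ (n ∸ i)) ≡ g i * f (n ∸ i)
    swap {i} i≤n = trans (cong (λ m → f (n ∸ i) * g m) (ℕ.m∸[m∸n]≡n i≤n)) (*-comm (f (n ∸ i)) (g i))

  ∗-assoc : ∀ f g h → (f ∗ g) ∗ h ≗ f ∗ (g ∗ h)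
  ∗-assoc f g h n = begin
    sumTo n (λ i → (f ∗ g) i * h (n ∸ i))
      ≡⟨ sumTo-cong n (λ {i} _ → sumTo-*ʳ i (h (n ∸ i)) (λ j → f j * g (i ∸ j))) ⟨
    sumTo n (λ i → sumTo i (λ j → f j * g (i ∸ j) * h (n ∸ i)))
      ≡⟨ sumTo-triangle n (λ i j → f j * g (i ∸ j) * h (n ∸ i)) ⟩
    sumTo n (λ j → sumTo (n ∸ j) (λ k → f j * g (j ℕ.+ k ∸ j) * h (n ∸ (j ℕ.+ k))))
      ≡⟨ sumTo-cong n (λ {j} _ → sumTo-cong (n ∸ j) (λ {k} _ → regroup j k)) ⟩
    sumTo n (λ j → sumTo (n ∸ j) (λ k → f j * (g k * h (n ∸ j ∸ k))))
      ≡⟨ sumTo-cong n (λ {j} _ → sumTo-*ˡ (n ∸ j) (f j) (λ k → g k * h (n ∸ j ∸ k))) ⟩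
    (f ∗ (g ∗ h)) n ∎
    where
    regroup : ∀ j k → f j * g (j ℕ.+ k ∸ j) * h (n ∸ (j ℕ.+ k)) ≡ f j * (g k * h (n ∸ j ∸ k))
    regroup j k = trans (cong₂ (λ a b → f j * g a * h b) (ℕ.m+n∸m≡n j k) (sym (ℕ.∸-+-assoc n j k)))
                        (*-assoc (f j) (g k) (h (n ∸ j ∸ k)))

  ∗-identityˡ : ∀ f → δ ∗ f ≗ f
  ∗-identityˡ f zero    = *-identityˡ (f 0)
  ∗-identityˡ f (suc n) = begin
    (δ ∗ f) (suc n)                                   ≡⟨ sumTo-sucˡ n _ ⟩
    1ℚ * f (suc n) + sumTo n (λ i → 0ℚ * f (n ∸ i))
      ≡⟨ cong₂ _+_ (*-identityˡ (f (suc n))) (sumTo-zero n (λ {i} _ → *-zeroˡ (f (n ∸ i)))) ⟩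
    f (suc n) + 0ℚ                                    ≡⟨ +-identityʳ (f (suc n)) ⟩
    f (suc n)                                         ∎

  ∗-identityʳ : ∀ f → f ∗ δ ≗ f
  ∗-identityʳ f n = trans (∗-comm f δ n) (∗-identityˡ f n)

  ∗-congˡ : ∀ f {g g′} → g ≗ g′ → f ∗ g ≗ f ∗ g′
  ∗-congˡ f g≗g′ n = sumTo-cong n (λ {i} _ → cong (f i *_) (g≗g′ (n ∸ i)))

  ∗-congʳ : ∀ {f f′} g → f ≗ f′ → f ∗ g ≗ f′ ∗ g
  ∗-congʳ g f≗f′ n = sumTo-cong n (λ {i} _ → cong (_* g (n ∸ i)) (f≗f′ i))

  ∗-distribˡ-+ : ∀ f g h n → (f ∗ (λ i → g i + h i)) n ≡ (f ∗ g) n + (f ∗ h) n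
  ∗-distribˡ-+ f g h n = trans (sumTo-cong n (λ {i} _ → *-distribˡ-+ (f i) (g (n ∸ i)) (h (n ∸ i))))
                               (sumTo-+ n (λ i → f i * g (n ∸ i)) (λ i → f i * h (n ∸ i)))

  neg-distribʳ-∗ : ∀ f g n → (f ∗ (λ i → - g i)) n ≡ - (f ∗ g) n
  neg-distribʳ-∗ f g n = trans (sumTo-cong n (λ {i} _ → sym (neg-distribʳ-* (f i) (g (n ∸ i)))))
                               (sumTo-neg n (λ i → f i * g (n ∸ i)))

  ∗-suc : ∀ f g n → (f ∗ g) (suc n) ≡ (f ∗ (g ∘ suc)) n + f (suc n) * g 0
  ∗-suc f g n = cong₂ _+_ (sumTo-cong n (λ {i} i≤n → cong (λ m → f i * g m) (ℕ.+-∸-assoc 1 i≤n)))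
                          (cong (λ m → f (suc n) * g m) (ℕ.n∸n≡0 n))

  ∗-cancelˡ : ∀ g f → g ∗ f ≗ δ → ∀ {a b} → f ∗ a ≗ f ∗ b → a ≗ b
  ∗-cancelˡ g f g∗f≗δ {a} {b} f∗a≗f∗b n = begin
    a n                  ≡⟨ ∗-identityˡ a n ⟨
    (δ ∗ a) n            ≡⟨ ∗-congʳ a g∗f≗δ n ⟨
    (g ∗ f ∗ a) n        ≡⟨ ∗-assoc g f a n ⟩
    (g ∗ (f ∗ a)) n      ≡⟨ ∗-congˡ g f∗a≗f∗b n ⟩
    (g ∗ (f ∗ b)) n      ≡⟨ ∗-assoc g f b n ⟨
    (g ∗ f ∗ b) n        ≡⟨ ∗-congʳ b g∗f≗δ n ⟩
    (δ ∗ b) n            ≡⟨ ∗-identityˡ b n ⟩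
    b n                  ∎

  X-suc : X ∘ suc ≗ δ
  X-suc zero    = refl
  X-suc (suc n) = refl

  ∗-X : ∀ f n → (f ∗ X) (suc n) ≡ f n
  ∗-X f n = begin
    (f ∗ X) (suc n)                       ≡⟨ ∗-suc f X n ⟩
    (f ∗ (X ∘ suc)) n + f (suc n) * 0ℚ    ≡⟨ cong₂ _+_ (∗-congˡ f X-suc n) (*-zeroʳ (f (suc n))) ⟩
    (f ∗ δ) n + 0ℚ                        ≡⟨ +-identityʳ _ ⟩
    (f ∗ δ) n                             ≡⟨ ∗-identityʳ f n ⟩
    f n                                   ∎

  alt : ℕ → ℚ
  alt zero    = 1ℚ
  alt (suc n) = - alt n

  alt-+ : ∀ m n → alt (m ℕ.+ n) ≡ alt m * alt n
  alt-+ zero    n = sym (*-identityˡ (alt n))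
  alt-+ (suc m) n = trans (cong -_ (alt-+ m n)) (neg-distribˡ-* (alt m) (alt n))

  reflect : Series → Series
  reflect f n = alt n * f n

  reflect-∗ : ∀ f g → reflect (f ∗ g) ≗ reflect f ∗ reflect g
  reflect-∗ f g n = sym (trans (sumTo-cong n regroup) (sumTo-*ˡ n (alt n) (λ i → f i * g (n ∸ i))))
    where
    regroup : ∀ {i} → i ≤ n → alt i * f i * (alt (n ∸ i) * g (n ∸ i)) ≡ alt n * (f i * g (n ∸ i))
    regroup {i} i≤n = begin
      alt i * f i * (alt (n ∸ i) * g (n ∸ i))
        ≡⟨ solve 4 (λ a b u v → (a :* u) :* (b :* v) := (a :* b) :* (u :* v)) refl
                   (alt i) (alt (n ∸ i)) (f i) (g (n ∸ i)) ⟩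
      alt i * alt (n ∸ i) * (f i * g (n ∸ i))
        ≡⟨ cong (_* (f i * g (n ∸ i))) (trans (sym (alt-+ i (n ∸ i))) (cong alt (ℕ.m+[n∸m]≡n i≤n))) ⟩
      alt n * (f i * g (n ∸ i)) ∎

  reflect-δ : reflect δ ≗ δ
  reflect-δ zero    = refl
  reflect-δ (suc n) = *-zeroʳ (alt (suc n))

  ι : ℕ → ℚ
  ι n = fromℤ (+ n)

  ι-+ : ∀ m n → ι (m ℕ.+ n) ≡ ι m + ι n
  ι-+ m n = toℚᵘ-injective (ℚᵘ.≃-trans (ℚᵘ.*≡* cross) (ℚᵘ.≃-sym (toℚᵘ-homo-+ (ι m) (ι n))))
    where
    cross : + (m ℕ.+ n) ℤ.* + 1 ≡ (+ m ℤ.* + 1 ℤ.+ + n ℤ.* + 1) ℤ.* + 1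
    cross = begin
      + (m ℕ.+ n) ℤ.* + 1                   ≡⟨ ℤ.*-identityʳ _ ⟩
      + (m ℕ.+ n)                           ≡⟨ ℤ.pos-+ m n ⟩
      + m ℤ.+ + n                           ≡⟨ cong₂ ℤ._+_ (ℤ.*-identityʳ (+ m)) (ℤ.*-identityʳ (+ n)) ⟨
      + m ℤ.* + 1 ℤ.+ + n ℤ.* + 1           ≡⟨ ℤ.*-identityʳ _ ⟨
      (+ m ℤ.* + 1 ℤ.+ + n ℤ.* + 1) ℤ.* + 1 ∎

  ι-*-inverse : ∀ n → ι (suc n) * ((+ 1) / suc n) ≡ 1ℚ
  ι-*-inverse n = toℚᵘ-injective (ℚᵘ.≃-trans (toℚᵘ-homo-* (ι (suc n)) ((+ 1) / suc n))
    (ℚᵘ.≃-trans (ℚᵘ.*-congˡ {toℚᵘ (ι (suc n))} (toℚᵘ-fromℚᵘ (ℚᵘ.mkℚᵘ (+ 1) n))) (ℚᵘ.*≡* cross)))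
    where
    cross : + suc n ℤ.* + 1 ℤ.* + 1 ≡ + 1 ℤ.* (+ 1 ℤ.* + suc n)
    cross = begin
      + suc n ℤ.* + 1 ℤ.* + 1     ≡⟨ ℤ.*-identityʳ (+ suc n ℤ.* + 1) ⟩
      + suc n ℤ.* + 1             ≡⟨ ℤ.*-identityʳ (+ suc n) ⟩
      + suc n                     ≡⟨ ℤ.*-identityˡ (+ suc n) ⟨
      + 1 ℤ.* + suc n             ≡⟨ ℤ.*-identityˡ (+ 1 ℤ.* + suc n) ⟨
      + 1 ℤ.* (+ 1 ℤ.* + suc n)   ∎

  θ : Series → Series
  θ f n = ι n * f n

  D : Series → Series
  D f n = θ f (suc n)

  θ-∗ : ∀ f g n → θ (f ∗ g) n ≡ (θ f ∗ g) n + (f ∗ θ g) n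
  θ-∗ f g n = begin
    ι n * sumTo n (λ i → f i * g (n ∸ i))           ≡⟨ sumTo-*ˡ n (ι n) (λ i → f i * g (n ∸ i)) ⟨
    sumTo n (λ i → ι n * (f i * g (n ∸ i)))         ≡⟨ sumTo-cong n split ⟩
    sumTo n (λ i → θ f i * g (n ∸ i) + f i * θ g (n ∸ i))
      ≡⟨ sumTo-+ n (λ i → θ f i * g (n ∸ i)) (λ i → f i * θ g (n ∸ i)) ⟩
    (θ f ∗ g) n + (f ∗ θ g) n                       ∎
    where
    split : ∀ {i} → i ≤ n → ι n * (f i * g (n ∸ i)) ≡ θ f i * g (n ∸ i) + f i * θ g (n ∸ i)
    split {i} i≤n = begin
      ι n * (f i * g (n ∸ i))
        ≡⟨ cong (λ m → ι m * (f i * g (n ∸ i))) (ℕ.m+[n∸m]≡n i≤n) ⟨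
      ι (i ℕ.+ (n ∸ i)) * (f i * g (n ∸ i))
        ≡⟨ cong (_* (f i * g (n ∸ i))) (ι-+ i (n ∸ i)) ⟩
      (ι i + ι (n ∸ i)) * (f i * g (n ∸ i))
        ≡⟨ solve 4 (λ a b u v → (a :+ b) :* (u :* v) := a :* u :* v :+ u :* (b :* v)) refl
                   (ι i) (ι (n ∸ i)) (f i) (g (n ∸ i)) ⟩
      θ f i * g (n ∸ i) + f i * θ g (n ∸ i) ∎

  θ-∗-suc : ∀ f g n → (θ f ∗ g) (suc n) ≡ (D f ∗ g) n
  θ-∗-suc f g n = begin
    (θ f ∗ g) (suc n)                   ≡⟨ sumTo-sucˡ n (λ i → θ f i * g (suc n ∸ i)) ⟩
    0ℚ * f 0 * g (suc n) + (D f ∗ g) n  ≡⟨ cong (λ x → x * g (suc n) + (D f ∗ g) n) (*-zeroˡ (f 0)) ⟩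
    0ℚ * g (suc n) + (D f ∗ g) n        ≡⟨ cong (_+ (D f ∗ g) n) (*-zeroˡ (g (suc n))) ⟩
    0ℚ + (D f ∗ g) n                    ≡⟨ +-identityˡ _ ⟩
    (D f ∗ g) n                         ∎

  D-∗ : ∀ f g n → D (f ∗ g) n ≡ (D f ∗ g) n + (f ∗ D g) n
  D-∗ f g n = begin
    D (f ∗ g) n                               ≡⟨ θ-∗ f g (suc n) ⟩
    (θ f ∗ g) (suc n) + (f ∗ θ g) (suc n)     ≡⟨ cong (_+_ ((θ f ∗ g) (suc n))) (∗-comm f (θ g) (suc n)) ⟩
    (θ f ∗ g) (suc n) + (θ g ∗ f) (suc n)     ≡⟨ cong₂ _+_ (θ-∗-suc f g n) (θ-∗-suc g f n) ⟩
    (D f ∗ g) n + (D g ∗ f) n                 ≡⟨ cong (_+_ ((D f ∗ g) n)) (∗-comm (D g) f n) ⟩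
    (D f ∗ g) n + (f ∗ D g) n                 ∎

  D-reflect : ∀ f n → D (reflect f) n ≡ - reflect (D f) n
  D-reflect f n =
    solve 3 (λ a s x → a :* ((:- s) :* x) := :- (s :* (a :* x))) refl (ι (suc n)) (alt n) (f (suc n))

  D≡0⇒f[1+n]≡0 : ∀ f → (∀ n → D f n ≡ 0ℚ) → ∀ n → f (suc n) ≡ 0ℚ
  D≡0⇒f[1+n]≡0 f Df≡0 n = begin
    f (suc n)                          ≡⟨ *-identityˡ (f (suc n)) ⟨
    1ℚ * f (suc n)                     ≡⟨ cong (_* f (suc n)) (trans (*-comm r (ι (suc n))) (ι-*-inverse n)) ⟨
    r * ι (suc n) * f (suc n)          ≡⟨ *-assoc r (ι (suc n)) (f (suc n)) ⟩
    r * D f n                          ≡⟨ cong (r *_) (Df≡0 n) ⟩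
    r * 0ℚ                             ≡⟨ *-zeroʳ r ⟩
    0ℚ                                 ∎
    where
    r : ℚ
    r = (+ 1) / suc n

  D-exp : D invFact ≗ invFact
  D-exp n = begin
    ι (suc n) * (invFact n * r)
      ≡⟨ solve 3 (λ a b c → a :* (b :* c) := b :* (a :* c)) refl (ι (suc n)) (invFact n) r ⟩
    invFact n * (ι (suc n) * r)   ≡⟨ cong (invFact n *_) (ι-*-inverse n) ⟩
    invFact n * 1ℚ                ≡⟨ *-identityʳ (invFact n) ⟩
    invFact n                     ∎
    where
    r : ℚ
    r = (+ 1) / suc n

  exp-∗-reflect-exp : invFact ∗ reflect invFact ≗ δ
  exp-∗-reflect-exp zero    = refl
  exp-∗-reflect-exp (suc n) = D≡0⇒f[1+n]≡0 (e ∗ reflect e) derivative-vanishes n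
    where
    e : Series
    e = invFact
    derivative-vanishes : ∀ n → D (e ∗ reflect e) n ≡ 0ℚ
    derivative-vanishes n = begin
      D (e ∗ reflect e) n                               ≡⟨ D-∗ e (reflect e) n ⟩
      (D e ∗ reflect e) n + (e ∗ D (reflect e)) n
        ≡⟨ cong₂ _+_ (∗-congʳ (reflect e) D-exp n)
                     (∗-congˡ e (λ i → trans (D-reflect e i) (cong (λ x → - (alt i * x)) (D-exp i))) n) ⟩
      (e ∗ reflect e) n + (e ∗ (λ i → - reflect e i)) n
        ≡⟨ cong (_+_ ((e ∗ reflect e) n)) (neg-distribʳ-∗ e (reflect e) n) ⟩
      (e ∗ reflect e) n + - (e ∗ reflect e) n           ≡⟨ +-inverseʳ ((e ∗ reflect e) n) ⟩
      0ℚ                                                ∎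

  exp-∗-reflect-expm1Div : invFact ∗ reflect expm1Div ≗ expm1Div
  exp-∗-reflect-expm1Div n = begin
    (e ∗ reflect expm1Div) n                   ≡⟨ ∗-congˡ e shifted n ⟩
    (e ∗ (λ i → - reflect e (suc i))) n        ≡⟨ neg-distribʳ-∗ e (reflect e ∘ suc) n ⟩
    - (e ∗ (reflect e ∘ suc)) n                ≡⟨ cong -_ (inverseʳ-unique _ _ product-vanishes) ⟩
    - - e (suc n)                              ≡⟨ neg-involutive (e (suc n)) ⟩
    expm1Div n                                 ∎
    where
    e : Series
    e = invFact
    shifted : reflect expm1Div ≗ (λ i → - reflect e (suc i))
    shifted i = trans (sym (neg-involutive (alt i * e (suc i)))) (cong -_ (neg-distribˡ-* (alt i) (e (suc i))))
    product-vanishes : e (suc n) + (e ∗ (reflect e ∘ suc)) n ≡ 0ℚ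
    product-vanishes = begin
      e (suc n) + (e ∗ (reflect e ∘ suc)) n        ≡⟨ +-comm (e (suc n)) ((e ∗ (reflect e ∘ suc)) n) ⟩
      (e ∗ (reflect e ∘ suc)) n + e (suc n)
        ≡⟨ cong (_+_ ((e ∗ (reflect e ∘ suc)) n)) (*-identityʳ (e (suc n))) ⟨
      (e ∗ (reflect e ∘ suc)) n + e (suc n) * 1ℚ  ≡⟨ ∗-suc e (reflect e) n ⟨
      (e ∗ reflect e) (suc n)                      ≡⟨ exp-∗-reflect-exp (suc n) ⟩
      0ℚ                                           ∎

module Parity where

  open import Data.Nat using (zero; suc; _+_; _%_)
  open import Data.Nat.DivMod using (%-distribˡ-+)
  open import Relation.Nullary using (contradiction)
  open import Relation.Binary.PropositionalEquality

  [1+n]%2≡1 : ∀ n → n % 2 ≡ 0 → suc n % 2 ≡ 1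
  [1+n]%2≡1 n n%2≡0 = trans (%-distribˡ-+ 1 n 2) (cong (λ r → (1 + r) % 2) n%2≡0)

  n%2≢1⇒n%2≡0 : ∀ n → n % 2 ≢ 1 → n % 2 ≡ 0
  n%2≢1⇒n%2≡0 zero          _     = refl
  n%2≢1⇒n%2≡0 (suc zero)    n%2≢1 = contradiction refl n%2≢1
  n%2≢1⇒n%2≡0 (suc (suc n)) n%2≢1 = n%2≢1⇒n%2≡0 n n%2≢1

module Bernoulli where

  open Sums
  open PowerSeries
  open Parity
  open import Data.Nat using (zero; suc; _∸_; _≤_; _<_; _≤′_; ≤′-refl; ≤′-step; _%_; z≤n; s≤s)
  import Data.Nat.Properties as ℕ
  open import Data.Rational using (ℚ; 0ℚ; 1ℚ; ½; _+_; _*_; -_)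
  open import Data.Rational.Properties
  open import Data.Rational.Solver using (module +-*-Solver)
  open +-*-Solver using (solve; _:+_; _:*_; :-_; _:=_; con)
  open import Algebra.Properties.Group +-0-group using () renaming (⁻¹-involutive to neg-involutive)
  open import Relation.Nullary using (yes; no; contradiction)
  open import Relation.Binary.PropositionalEquality
  open ≡-Reasoning

  βTable-suc : ∀ {n i} → i ≤ n → βTable (suc n) i ≡ βTable n i
  βTable-suc {n} {i} i≤n with i ℕ.≤? n
  ... | yes _   = refl
  ... | no  i≰n = contradiction i≤n i≰n

  βTable-stable : ∀ {n i} → i ≤′ n → βTable n i ≡ β i
  βTable-stable ≤′-refl        = refl
  βTable-stable (≤′-step i≤′n) = trans (βTable-suc (ℕ.≤′⇒≤ i≤′n)) (βTable-stable i≤′n)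

  β-suc : ∀ m → β (suc m) ≡ - sumTo m (λ j → expm1Div (suc j) * β (m ∸ j))
  β-suc m = trans (recurrence m) (cong -_ (sumTo-cong m (λ {j} _ →
    cong (expm1Div (suc j) *_) (βTable-stable (ℕ.≤⇒≤′ (ℕ.m∸n≤m m j))))))
    where
    recurrence : ∀ m → β (suc m) ≡ - sumTo m (λ j → expm1Div (suc j) * βTable m (m ∸ j))
    recurrence m with suc m ℕ.≤? m
    ... | yes 1+m≤m = contradiction 1+m≤m (ℕ.1+n≰n)
    ... | no  _ with suc m ℕ.≟ suc m
    ...   | yes _  = refl
    ...   | no  ≢m = contradiction refl ≢m

  expm1Div-∗-β : expm1Div ∗ β ≗ δ
  expm1Div-∗-β zero    = refl
  expm1Div-∗-β (suc m) = begin
    (expm1Div ∗ β) (suc m)           ≡⟨ sumTo-sucˡ m (λ i → expm1Div i * β (suc m ∸ i)) ⟩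
    expm1Div 0 * β (suc m) + S       ≡⟨ cong (λ b → expm1Div 0 * b + S) (β-suc m) ⟩
    1ℚ * - S + S                     ≡⟨ cong (_+ S) (*-identityˡ (- S)) ⟩
    - S + S                          ≡⟨ +-inverseˡ S ⟩
    0ℚ                               ∎
    where
    S : ℚ
    S = sumTo m (λ i → expm1Div (suc i) * β (m ∸ i))

  reflect-β : ∀ n → reflect β n ≡ X n + β n
  reflect-β = ∗-cancelˡ β E (λ n → trans (∗-comm β E n) (expm1Div-∗-β n))
                         (λ n → trans (times-reflect-β n) (sym (times-X+β n)))
    where
    E e : Series
    E = expm1Div
    e = invFact
    times-reflect-β : E ∗ reflect β ≗ e
    times-reflect-β n = begin
      (E ∗ reflect β) n                ≡⟨ ∗-congʳ (reflect β) exp-∗-reflect-expm1Div n ⟨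
      (e ∗ reflect E ∗ reflect β) n    ≡⟨ ∗-assoc e (reflect E) (reflect β) n ⟩
      (e ∗ (reflect E ∗ reflect β)) n  ≡⟨ ∗-congˡ e (λ i → sym (reflect-∗ E β i)) n ⟩
      (e ∗ reflect (E ∗ β)) n
        ≡⟨ ∗-congˡ e (λ i → trans (cong (alt i *_) (expm1Div-∗-β i)) (reflect-δ i)) n ⟩
      (e ∗ δ) n                        ≡⟨ ∗-identityʳ e n ⟩
      e n                              ∎
    times-X+β : E ∗ (λ n → X n + β n) ≗ e
    times-X+β zero    = refl
    times-X+β (suc n) = begin
      (E ∗ (λ n → X n + β n)) (suc n)  ≡⟨ ∗-distribˡ-+ E X β (suc n) ⟩
      (E ∗ X) (suc n) + (E ∗ β) (suc n) ≡⟨ cong₂ _+_ (∗-X E n) (expm1Div-∗-β (suc n)) ⟩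
      E n + 0ℚ                          ≡⟨ +-identityʳ (E n) ⟩
      e (suc n)                         ∎

  alt-odd : ∀ n → n % 2 ≡ 1 → alt n ≡ - 1ℚ
  alt-odd (suc zero)    _     = refl
  alt-odd (suc (suc n)) n%2≡1 = trans (neg-involutive (alt n)) (alt-odd n n%2≡1)

  self-negating⇒0 : ∀ b → - b ≡ b → b ≡ 0ℚ
  self-negating⇒0 b -b≡b = begin
    b                        ≡⟨ solve 1 (λ b → b := con ½ :* b :+ con ½ :* b) refl b ⟩
    ½ * b + ½ * b            ≡⟨ cong (λ x → ½ * x + ½ * b) -b≡b ⟨
    ½ * - b + ½ * b          ≡⟨ solve 1 (λ b → con ½ :* (:- b) :+ con ½ :* b := con 0ℚ) refl b ⟩
    0ℚ                       ∎

  β-odd : ∀ n → 1 < n → n % 2 ≡ 1 → β n ≡ 0ℚ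
  β-odd (suc zero)    (s≤s ())
  β-odd (suc (suc n)) _ n%2≡1 = self-negating⇒0 b (begin
    - b                        ≡⟨ cong -_ (*-identityˡ b) ⟨
    - (1ℚ * b)                 ≡⟨ neg-distribˡ-* 1ℚ b ⟩
    - 1ℚ * b                   ≡⟨ cong (_* b) (alt-odd (suc (suc n)) n%2≡1) ⟨
    reflect β (suc (suc n))    ≡⟨ reflect-β (suc (suc n)) ⟩
    0ℚ + b                     ≡⟨ +-identityˡ b ⟩
    b                          ∎)
    where
    b : ℚ
    b = β (suc (suc n))

  λc-even : ∀ k → k % 2 ≡ 0 → λc k ≡ 0ℚ
  λc-even zero    _       = refl  -- β 1 evaluates to -½
  λc-even (suc k) 1+k%2≡0 = β-odd (suc (suc k)) (s≤s (s≤s z≤n)) ([1+n]%2≡1 (suc k) 1+k%2≡0)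

module AdditiveSupport
  (S : ℕ → ℕ → Set)
  (S? : ∀ k j → Dec (S k j))
  (S-0 : S 0 0)
  (S-+ : ∀ {a b c d} → S a b → S c d → S (a ℕ.+ c) (b ℕ.+ d))
  where

  open Sums
  open import Data.Nat using (zero; suc; _∸_; _≤_)
  open import Data.Nat.Properties using (m+[n∸m]≡n)
  open import Data.Rational using (0ℚ; _*_)
  open import Data.Rational.Properties using (*-zeroˡ; *-zeroʳ)
  open import Relation.Nullary using (yes; no; ¬_; contradiction)
  open import Relation.Binary.PropositionalEquality

  SupportedIn : BiSeries → Set
  SupportedIn F = ∀ k j → ¬ S k j → F k j ≡ 0ℚ

  oneS-supported : SupportedIn oneS
  oneS-supported zero    zero    ¬S00 = contradiction S-0 ¬S00
  oneS-supported zero    (suc j) _    = refl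
  oneS-supported (suc k) j       _    = refl

  ⊛-supported : ∀ {F G} → SupportedIn F → SupportedIn G → SupportedIn (F ⊛ G)
  ⊛-supported {F} {G} F-supported G-supported k j ¬Skj =
    sumTo-zero k (λ a≤k → sumTo-zero j (λ b≤j → term a≤k b≤j))
    where
    term : ∀ {a b} → a ≤ k → b ≤ j → F a b * G (k ∸ a) (j ∸ b) ≡ 0ℚ
    term {a} {b} a≤k b≤j with S? a b | S? (k ∸ a) (j ∸ b)
    ... | no ¬Sab | _         =
      trans (cong (_* G (k ∸ a) (j ∸ b)) (F-supported a b ¬Sab)) (*-zeroˡ (G (k ∸ a) (j ∸ b)))
    ... | yes _   | no ¬Srest =
      trans (cong (F a b *_) (G-supported (k ∸ a) (j ∸ b) ¬Srest)) (*-zeroʳ (F a b))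
    ... | yes Sab | yes Srest =
      contradiction (subst₂ S (m+[n∸m]≡n a≤k) (m+[n∸m]≡n b≤j) (S-+ Sab Srest)) ¬Skj

  powS-supported : ∀ {F} → SupportedIn F → ∀ n → SupportedIn (powS F n)
  powS-supported F-supported zero    = oneS-supported
  powS-supported F-supported (suc n) = ⊛-supported (powS-supported F-supported n) F-supported

  expS-supported : ∀ {F} → SupportedIn F → SupportedIn (expS F)
  expS-supported {F} F-supported k j ¬Skj = sumTo-zero k term
    where
    term : ∀ {n} → n ≤ k → invFact n * powS F n k j ≡ 0ℚ
    term {n} _ = trans (cong (invFact n *_) (powS-supported F-supported n k j ¬Skj)) (*-zeroʳ (invFact n))

module MonomialSpan where

  open import Data.Nat using (_≟_)
  open import Data.List using ([]; _∷_)
  open import Data.List.Membership.DecPropositional _≟_ using (_∈_; _∉_; _∈?_)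
  open import Data.List.Relation.Unary.Any using (here; there)
  import Data.List.Relation.Unary.All as All
  open import Data.List.Relation.Unary.AllPairs using (_∷_)
  open import Data.List.Relation.Unary.Unique.Propositional using (Unique)
  open import Data.Rational using (ℚ; 0ℚ; 1ℚ; _+_; _*_)
  open import Data.Rational.Properties using (*-zeroʳ; *-identityʳ; +-identityˡ; +-identityʳ)
  open import Data.Product using (_,_)
  open import Function using (_∘_)
  open import Relation.Nullary using (yes; no; contradiction)
  open import Relation.Binary.PropositionalEquality
  open ≡-Reasoning

  monomial-≢ : ∀ {e j} → e ≢ j → monomial e j ≡ 0ℚ
  monomial-≢ {e} {j} e≢j with e ≟ j
  ... | yes e≡j = contradiction e≡j e≢j
  ... | no  _   = refl

  monomial-refl : ∀ j → monomial j j ≡ 1ℚ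
  monomial-refl j with j ≟ j
  ... | yes _   = refl
  ... | no  j≢j = contradiction refl j≢j

  sumList-monomial-∉ : ∀ (c : ℕ → ℚ) {j} es → j ∉ es → sumList es (λ e → c e * monomial e j) ≡ 0ℚ
  sumList-monomial-∉ c []       _   = refl
  sumList-monomial-∉ c (e ∷ es) j∉ = cong₂ _+_
    (trans (cong (c e *_) (monomial-≢ (j∉ ∘ here ∘ sym))) (*-zeroʳ (c e)))
    (sumList-monomial-∉ c es (j∉ ∘ there))

  sumList-monomial-∈ : ∀ (c : ℕ → ℚ) {j es} → Unique es → j ∈ es →
                       sumList es (λ e → c e * monomial e j) ≡ c j
  sumList-monomial-∈ c {es = j ∷ es} (j∉es ∷ _) (here refl) = begin
    c j * monomial j j + sumList es (λ e → c e * monomial e j)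
      ≡⟨ cong₂ _+_ (trans (cong (c j *_) (monomial-refl j)) (*-identityʳ (c j)))
                   (sumList-monomial-∉ c es (λ j∈es → All.lookup j∉es j∈es refl)) ⟩
    c j + 0ℚ ≡⟨ +-identityʳ (c j) ⟩
    c j      ∎
  sumList-monomial-∈ c {j} {e ∷ es} (e∉es ∷ unique) (there j∈es) = begin
    c e * monomial e j + sumList es (λ e → c e * monomial e j)
      ≡⟨ cong₂ _+_ (trans (cong (c e *_) (monomial-≢ (All.lookup e∉es j∈es))) (*-zeroʳ (c e)))
                   (sumList-monomial-∈ c unique j∈es) ⟩
    0ℚ + c j ≡⟨ +-identityˡ (c j) ⟩
    c j      ∎

  inMonomialSpan : ∀ {p es} → Unique es → (∀ j → j ∉ es → p j ≡ 0ℚ) → InMonomialSpan p es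
  inMonomialSpan {p} {es} unique vanishes = p , expansion
    where
    expansion : ∀ j → p j ≡ sumList es (λ e → p e * monomial e j)
    expansion j with j ∈? es
    ... | yes j∈es = sym (sumList-monomial-∈ p unique j∈es)
    ... | no  j∉es = trans (vanishes j j∉es) (sym (sumList-monomial-∉ p es j∉es))

module Progressions where

  open import Data.Nat using (zero; suc; _+_; _*_; _≤_; _<_; _%_; _/_)
  open import Data.Nat.Properties
    using (*-comm; *-suc; +-comm; suc-injective; *-cancelˡ-≡; +-monoʳ-≤; module ≤-Reasoning)
  open import Data.Nat.DivMod using (m≡m%n+[m/n]*n; m*n/n≡m; /-monoˡ-≤)
  open import Data.List using (upTo)
  open import Data.List.Membership.Propositional using (_∈_)
  open import Data.List.Membership.Propositional.Properties using (∈-map⁺; ∈-upTo⁺)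
  open import Data.List.Relation.Unary.Unique.Propositional using (Unique)
  open import Data.List.Relation.Unary.Unique.Propositional.Properties using (map⁺; upTo⁺)
  open import Relation.Nullary using (contradiction)
  open import Relation.Binary.PropositionalEquality

  oddsUpTo-unique : ∀ m → Unique (oddsUpTo m)
  oddsUpTo-unique m = map⁺ (λ eq → *-cancelˡ-≡ _ _ 2 (suc-injective eq)) (upTo⁺ m)

  evensUpTo-unique : ∀ m → Unique (evensUpTo m)
  evensUpTo-unique m = map⁺ (λ eq → *-cancelˡ-≡ _ _ 2 (suc-injective (suc-injective eq))) (upTo⁺ m)

  n≡n%2+2*[n/2] : ∀ j → j ≡ j % 2 + 2 * (j / 2)
  n≡n%2+2*[n/2] j = trans (m≡m%n+[m/n]*n j 2) (cong (j % 2 +_) (*-comm (j / 2) 2))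

  ∈-oddsUpTo : ∀ {j k} → j % 2 ≡ 1 → j ≤ k → j ∈ oddsUpTo ((k + 1) / 2)
  ∈-oddsUpTo {j} {k} j%2≡1 j≤k =
    subst (_∈ oddsUpTo ((k + 1) / 2)) (sym j≡1+2i) (∈-map⁺ _ (∈-upTo⁺ i<[k+1]/2))
    where
    i : ℕ
    i = j / 2
    j≡1+2i : j ≡ suc (2 * i)
    j≡1+2i = trans (n≡n%2+2*[n/2] j) (cong (_+ 2 * i) j%2≡1)
    i<[k+1]/2 : i < (k + 1) / 2
    i<[k+1]/2 = subst (_≤ (k + 1) / 2) (m*n/n≡m (suc i) 2) (/-monoˡ-≤ 2 (begin
      suc i * 2          ≡⟨ cong suc (cong suc (*-comm i 2)) ⟩
      suc (suc (2 * i))  ≡⟨ cong suc j≡1+2i ⟨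
      suc j              ≤⟨ +-monoʳ-≤ 1 j≤k ⟩
      suc k              ≡⟨ +-comm 1 k ⟩
      k + 1              ∎))
      where open ≤-Reasoning

  ∈-evensUpTo : ∀ {j k} → j % 2 ≡ 0 → 1 ≤ j → j ≤ k → j ∈ evensUpTo (k / 2)
  ∈-evensUpTo {j} {k} j%2≡0 1≤j j≤k
    with j / 2 | trans (n≡n%2+2*[n/2] j) (cong (_+ 2 * (j / 2)) j%2≡0) | /-monoˡ-≤ 2 j≤k
  ... | zero  | j≡0     | _     = contradiction (subst (1 ≤_) j≡0 1≤j) λ ()
  ... | suc i | j≡2[1+i] | i<k/2 =
    subst (_∈ evensUpTo (k / 2)) (sym (trans j≡2[1+i] (*-suc 2 i))) (∈-map⁺ _ (∈-upTo⁺ i<k/2))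

module Coefficients where

  open Parity using (n%2≢1⇒n%2≡0)
  open Bernoulli using (λc-even)
  open MonomialSpan using (inMonomialSpan)
  open import Data.Nat using (zero; suc; _+_; _≤_; _%_; _≟_; _≤?_; z≤n; s≤s)
  open import Data.Nat.Properties using (+-mono-≤; m+n≡0⇒m≡0; m+n≡0⇒n≡0)
  open import Data.Nat.DivMod using (%-distribˡ-+)
  open import Data.Product using (_×_; _,_)
  open import Data.List.Membership.Propositional using (_∈_)
  open import Data.List.Relation.Unary.Unique.Propositional using (Unique)
  open import Data.Rational using (-_)
  open import Function using (_∘_)
  open import Relation.Nullary using (_×-dec_; _→-dec_)
  open import Relation.Binary.PropositionalEquality

  -- The additive monoid generated by the exponents (k, 1), k odd, of the terms of -zλ(u).
  Support : ℕ → ℕ → Set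
  Support k j = j ≤ k × j % 2 ≡ k % 2 × (j ≡ 0 → k ≡ 0)

  Support? : ∀ k j → Dec (Support k j)
  Support? k j = j ≤? k ×-dec j % 2 ≟ k % 2 ×-dec (j ≟ 0 →-dec k ≟ 0)

  Support-0 : Support 0 0
  Support-0 = z≤n , refl , λ _ → refl

  Support-+ : ∀ {a b c d} → Support a b → Support c d → Support (a + c) (b + d)
  Support-+ {a} {b} {c} {d} (b≤a , b≡a , b≡0⇒a≡0) (d≤c , d≡c , d≡0⇒c≡0) =
    +-mono-≤ b≤a d≤c ,
    trans (%-distribˡ-+ b d 2) (trans (cong₂ (λ x y → (x + y) % 2) b≡a d≡c) (sym (%-distribˡ-+ a c 2))) ,
    λ b+d≡0 → cong₂ _+_ (b≡0⇒a≡0 (m+n≡0⇒m≡0 b b+d≡0)) (d≡0⇒c≡0 (m+n≡0⇒n≡0 b b+d≡0))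

  open AdditiveSupport Support Support? Support-0 Support-+

  minusZλ-supported : SupportedIn minusZλ
  minusZλ-supported k       zero          _     = refl
  minusZλ-supported zero    (suc zero)    _     = cong -_ (λc-even 0 refl)
  minusZλ-supported (suc k) (suc zero)    ¬S    =
    cong -_ (λc-even (suc k) (n%2≢1⇒n%2≡0 (suc k) (λ 1+k%2≡1 → ¬S (s≤s z≤n , sym 1+k%2≡1 , λ ()))))
  minusZλ-supported k       (suc (suc j)) _     = refl

  P-inMonomialSpan : ∀ k {es} → Unique es → (∀ {j} → Support k j → j ∈ es) → InMonomialSpan (P k) es
  P-inMonomialSpan k unique covers =
    inMonomialSpan unique (λ j j∉es → expS-supported minusZλ-supported k j (j∉es ∘ covers))

open import Data.Nat using (ℕ; _≤_; _+_; _%_; _/_)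
open import Data.Nat.Properties using (n≢0⇒n>0; <⇒≢)
open import Data.Product using (_×_; _,_)
open import Relation.Binary.PropositionalEquality using (_≡_; sym; trans)
open Progressions
open Coefficients using (P-inMonomialSpan)

corollary5p5 : (k : ℕ) → 1 ≤ k →
    (k % 2 ≡ 1 → InMonomialSpan (P k) (oddsUpTo ((k + 1) / 2))) ×
    (k % 2 ≡ 0 → InMonomialSpan (P k) (evensUpTo (k / 2)))
corollary5p5 k 1≤k = odd , even
  where
  odd : k % 2 ≡ 1 → InMonomialSpan (P k) (oddsUpTo ((k + 1) / 2))
  odd k%2≡1 = P-inMonomialSpan k (oddsUpTo-unique ((k + 1) / 2))
    λ (j≤k , j%2≡k%2 , _) → ∈-oddsUpTo (trans j%2≡k%2 k%2≡1) j≤k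
  even : k % 2 ≡ 0 → InMonomialSpan (P k) (evensUpTo (k / 2))
  even k%2≡0 = P-inMonomialSpan k (evensUpTo-unique (k / 2))
    λ (j≤k , j%2≡k%2 , j≡0⇒k≡0) →
      ∈-evensUpTo (trans j%2≡k%2 k%2≡0) (n≢0⇒n>0 (λ j≡0 → <⇒≢ 1≤k (sym (j≡0⇒k≡0 j≡0)))) j≤k
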